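{- Let $n\ge0$ and $0\le i<3^n$ with $C_n(i)=1$. Then for every $m\ge0$ and every $0\le k<3^m$, $C_{n+m}(3^m i+k)=C_m(k)$.
   Context: The unit weight-$3$ Stern–Brocot sequences $SB_n$ ($n\ge0$): $SB_0=(\frac{0}{1},\frac{1}{1})$, and $SB_{n+1}$ is obtained from $SB_n$ by keeping all its terms in order and inserting, between each pair of consecutive terms $\frac{p}{q},\frac{r}{s}$ (in lowest terms, positive denominators), the two fractions $\frac{2p+r}{2q+s}$ and $\frac{p+2r}{q+2s}$, each reduced to lowest terms, in this order. $SB_n$ has $3^n+1$ terms, indexed from $0$. For $0\le i<3^n$, $C_n(i)=qr-ps$ where $\frac{p}{q}$ and $\frac{r}{s}$ are the $i$-th and $(i+1)$-th terms of $SB_n$ in lowest terms with positive denominators. -}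

module Defs where

open import Data.Nat as ℕ using (ℕ; zero; suc)
open import Data.Integer as ℤ using (ℤ; +_)
open import Data.Rational using (ℚ; _/_; ↥_; ↧_; ↧ₙ_; 0ℚ; 1ℚ)
open ℚ using (denominator-1)
open import Data.List using (List; []; _∷_)

-- Rationals in agda-stdlib are always stored in lowest terms with positive
-- denominator: numerator ↥ x, denominator ↧ₙ x = suc (denominator-1 x).

medL : ℚ → ℚ → ℚ
medL x y = (ℤ.+ 2 ℤ.* ↥ x ℤ.+ ↥ y) / (suc (denominator-1 y) ℕ.+ 2 ℕ.* ↧ₙ x)

medR : ℚ → ℚ → ℚ
medR x y = (↥ x ℤ.+ ℤ.+ 2 ℤ.* ↥ y) / (suc (denominator-1 x) ℕ.+ 2 ℕ.* ↧ₙ y)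

refine : List ℚ → List ℚ
refine [] = []
refine (x ∷ []) = x ∷ []
refine (x ∷ y ∷ rest) = x ∷ medL x y ∷ medR x y ∷ refine (y ∷ rest)

SB : ℕ → List ℚ
SB zero = 0ℚ ∷ 1ℚ ∷ []
SB (suc n) = refine (SB n)

-- i-th element of a list (0 if out of range; only used in range)
at : List ℚ → ℕ → ℚ
at [] _ = 0ℚ
at (x ∷ _) zero = x
at (_ ∷ xs) (suc i) = at xs i

cross : ℚ → ℚ → ℤ
cross x y = ↧ x ℤ.* ↥ y ℤ.- ↥ x ℤ.* ↧ y

C : ℕ → ℕ → ℤ
C n i = cross (at (SB n) i) (at (SB n) (suc i))

-- Every term of the sequences lies in [0, 1], so it can be written A / (A + T) with
-- natural A and T.  If x = p/q and y = r/s are consecutive terms with qr - ps = 1,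
-- the Möbius map φ(A / (A + T)) = (rA + pT) / (sA + qT) sends 0, 1 to x, y; having
-- determinant 1 it sends reduced fractions to reduced fractions, so it commutes with
-- both weighted mediants (which are linear in (A, T)) and preserves every cross
-- determinant.  The block of SB (n + m) between positions 3^m i and 3^m (i + 1) is
-- the m-fold refinement of (x, y), hence the image of SB m under φ.
module Submission where

open import Defs
open import Data.Nat as ℕ using (ℕ; zero; suc; pred; _+_; _*_; _^_; _∸_; _<_; _≤_; z≤n; s≤s)
open import Data.Nat.Properties
open import Data.Nat.Coprimality using (Coprime; recompute)
open import Data.Nat.Divisibility using (_∣_; ∣m+n∣m⇒∣n; ∣m∣n⇒∣m+n; ∣n⇒∣m*n)
open import Data.Nat.Tactic.RingSolver using (solve-∀)
open import Data.Integer as ℤ using (ℤ; +_; 0ℤ)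
import Data.Integer.Properties as ℤₚ
import Data.Integer.Tactic.RingSolver as ℤRing
open import Data.Rational using (ℚ; mkℚ; ↥_; ↧ₙ_; 0ℚ; 1ℚ; _/_; *≤*)
import Data.Rational.Properties as ℚₚ
import Data.Rational.Unnormalised as ℚᵘ
open import Data.List using (List; []; _∷_; [_]; _++_; length; map)
open import Data.List.Relation.Unary.All using (All; []; _∷_)
open import Data.Empty using (⊥-elim)
open import Data.Product using (_×_; _,_; proj₁; proj₂)
open import Relation.Binary.PropositionalEquality hiding ([_])

refineTail : ℚ → List ℚ → List ℚ
refineTail x [] = []
refineTail x (y ∷ l) = medL x y ∷ medR x y ∷ y ∷ refineTail y l

refineTailⁿ : ℕ → ℚ → List ℚ → List ℚ
refineTailⁿ zero x l = l
refineTailⁿ (suc m) x l = refineTail x (refineTailⁿ m x l)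

lastFrom : ℚ → List ℚ → ℚ
lastFrom x [] = x
lastFrom x (y ∷ l) = lastFrom y l

refine-∷ : ∀ x l → refine (x ∷ l) ≡ x ∷ refineTail x l
refine-∷ x [] = refl
refine-∷ x (y ∷ l) = cong (λ t → x ∷ medL x y ∷ medR x y ∷ t) (refine-∷ y l)

refineTailⁿ-+ : ∀ n m x l → refineTailⁿ (n + m) x l ≡ refineTailⁿ m x (refineTailⁿ n x l)
refineTailⁿ-+ n zero x l = cong (λ k → refineTailⁿ k x l) (+-identityʳ n)
refineTailⁿ-+ n (suc m) x l =
  trans (cong (λ k → refineTailⁿ k x l) (+-suc n m)) (cong (refineTail x) (refineTailⁿ-+ n m x l))

lastFrom-refineTail : ∀ x l → lastFrom x (refineTail x l) ≡ lastFrom x l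
lastFrom-refineTail x [] = refl
lastFrom-refineTail x (y ∷ l) = lastFrom-refineTail y l

lastFrom-refineTailⁿ : ∀ m x l → lastFrom x (refineTailⁿ m x l) ≡ lastFrom x l
lastFrom-refineTailⁿ zero x l = refl
lastFrom-refineTailⁿ (suc m) x l =
  trans (lastFrom-refineTail x (refineTailⁿ m x l)) (lastFrom-refineTailⁿ m x l)

refineTail-++ : ∀ x ys zs → refineTail x (ys ++ zs) ≡ refineTail x ys ++ refineTail (lastFrom x ys) zs
refineTail-++ x [] zs = refl
refineTail-++ x (y ∷ ys) zs = cong (λ t → medL x y ∷ medR x y ∷ y ∷ t) (refineTail-++ y ys zs)

refineTailⁿ-++ : ∀ m x ys zs →
  refineTailⁿ m x (ys ++ zs) ≡ refineTailⁿ m x ys ++ refineTailⁿ m (lastFrom x ys) zs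
refineTailⁿ-++ zero x ys zs = refl
refineTailⁿ-++ (suc m) x ys zs = begin
  refineTail x (refineTailⁿ m x (ys ++ zs))
    ≡⟨ cong (refineTail x) (refineTailⁿ-++ m x ys zs) ⟩
  refineTail x (refineTailⁿ m x ys ++ refineTailⁿ m (lastFrom x ys) zs)
    ≡⟨ refineTail-++ x (refineTailⁿ m x ys) _ ⟩
  refineTail x (refineTailⁿ m x ys) ++ refineTail (lastFrom x (refineTailⁿ m x ys)) (refineTailⁿ m (lastFrom x ys) zs)
    ≡⟨ cong (λ z → refineTail x (refineTailⁿ m x ys) ++ refineTail z (refineTailⁿ m (lastFrom x ys) zs))
            (lastFrom-refineTailⁿ m x ys) ⟩
  refineTail x (refineTailⁿ m x ys) ++ refineTail (lastFrom x ys) (refineTailⁿ m (lastFrom x ys) zs) ∎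
  where open ≡-Reasoning

length-refineTail : ∀ x l → length (refineTail x l) ≡ 3 * length l
length-refineTail x [] = refl
length-refineTail x (y ∷ l) =
  trans (cong (λ n → 3 + n) (length-refineTail y l)) (sym (*-suc 3 (length l)))

length-refineTailⁿ : ∀ m x l → length (refineTailⁿ m x l) ≡ 3 ^ m * length l
length-refineTailⁿ zero x l = sym (+-identityʳ (length l))
length-refineTailⁿ (suc m) x l = begin
  length (refineTail x (refineTailⁿ m x l)) ≡⟨ length-refineTail x (refineTailⁿ m x l) ⟩
  3 * length (refineTailⁿ m x l)            ≡⟨ cong (3 *_) (length-refineTailⁿ m x l) ⟩
  3 * (3 ^ m * length l)                    ≡⟨ *-assoc 3 (3 ^ m) _ ⟨
  3 ^ suc m * length l                      ∎
  where open ≡-Reasoning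

length-refineTailⁿ-singleton : ∀ m x y → length (refineTailⁿ m x [ y ]) ≡ 3 ^ m
length-refineTailⁿ-singleton m x y = trans (length-refineTailⁿ m x [ y ]) (*-identityʳ (3 ^ m))

at-++ˡ : ∀ x ys zs k → k ≤ length ys → at (x ∷ ys ++ zs) k ≡ at (x ∷ ys) k
at-++ˡ x ys zs zero _ = refl
at-++ˡ x (y ∷ ys) zs (suc k) (s≤s k≤) = at-++ˡ y ys zs k k≤

at-++ʳ : ∀ x ys zs j → at (x ∷ ys ++ zs) (length ys + j) ≡ at (lastFrom x ys ∷ zs) j
at-++ʳ x [] zs j = refl
at-++ʳ x (y ∷ ys) zs j = at-++ʳ y ys zs j

at-block : ∀ m x l i k → i < length l → k ≤ 3 ^ m →
  at (x ∷ refineTailⁿ m x l) (3 ^ m * i + k) ≡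
  at (at (x ∷ l) i ∷ refineTailⁿ m (at (x ∷ l) i) [ at l i ]) k
at-block m x (y ∷ l) zero k _ k≤ = begin
  at (x ∷ refineTailⁿ m x (y ∷ l)) (3 ^ m * 0 + k)
    ≡⟨ cong₂ at (cong (x ∷_) (refineTailⁿ-++ m x [ y ] l)) (cong (_+ k) (*-zeroʳ (3 ^ m))) ⟩
  at (x ∷ refineTailⁿ m x [ y ] ++ refineTailⁿ m y l) k
    ≡⟨ at-++ˡ x (refineTailⁿ m x [ y ]) _ k (subst (k ≤_) (sym (length-refineTailⁿ-singleton m x y)) k≤) ⟩
  at (x ∷ refineTailⁿ m x [ y ]) k ∎
  where open ≡-Reasoning
at-block m x (y ∷ l) (suc i) k (s≤s i<) k≤ = begin
  at (x ∷ refineTailⁿ m x (y ∷ l)) (3 ^ m * suc i + k)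
    ≡⟨ cong₂ at (cong (x ∷_) (refineTailⁿ-++ m x [ y ] l)) index≡ ⟩
  at (x ∷ refineTailⁿ m x [ y ] ++ refineTailⁿ m y l) (length (refineTailⁿ m x [ y ]) + (3 ^ m * i + k))
    ≡⟨ at-++ʳ x (refineTailⁿ m x [ y ]) _ _ ⟩
  at (lastFrom x (refineTailⁿ m x [ y ]) ∷ refineTailⁿ m y l) (3 ^ m * i + k)
    ≡⟨ cong (λ z → at (z ∷ refineTailⁿ m y l) (3 ^ m * i + k)) (lastFrom-refineTailⁿ m x [ y ]) ⟩
  at (y ∷ refineTailⁿ m y l) (3 ^ m * i + k)
    ≡⟨ at-block m y l i k i< k≤ ⟩
  at (at (y ∷ l) i ∷ refineTailⁿ m (at (y ∷ l) i) [ at l i ]) k ∎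
  where
  open ≡-Reasoning
  index≡ : 3 ^ m * suc i + k ≡ length (refineTailⁿ m x [ y ]) + (3 ^ m * i + k)
  index≡ = begin
    3 ^ m * suc i + k       ≡⟨ cong (_+ k) (*-suc (3 ^ m) i) ⟩
    3 ^ m + 3 ^ m * i + k   ≡⟨ +-assoc (3 ^ m) _ k ⟩
    3 ^ m + (3 ^ m * i + k) ≡⟨ cong (_+ _) (length-refineTailⁿ-singleton m x y) ⟨
    length (refineTailⁿ m x [ y ]) + (3 ^ m * i + k) ∎

at-map : ∀ (f : ℚ → ℚ) l k → k < length l → at (map f l) k ≡ f (at l k)
at-map f (a ∷ l) zero _ = refl
at-map f (a ∷ l) (suc k) (s≤s k<) = at-map f l k k<

All-at : ∀ {P : ℚ → Set} {l} → P 0ℚ → All P l → ∀ k → P (at l k)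
All-at P0 [] k = P0
All-at P0 (Pa ∷ Pl) zero = Pa
All-at P0 (Pa ∷ Pl) (suc k) = All-at P0 Pl k

module _ {P : ℚ → Set}
         (P-medL : ∀ {a b} → P a → P b → P (medL a b))
         (P-medR : ∀ {a b} → P a → P b → P (medR a b)) where

  All-refineTail : ∀ {x l} → P x → All P l → All P (refineTail x l)
  All-refineTail Px [] = []
  All-refineTail Px (Py ∷ Pl) = P-medL Px Py ∷ P-medR Px Py ∷ Py ∷ All-refineTail Py Pl

  All-refineTailⁿ : ∀ m {x l} → P x → All P l → All P (refineTailⁿ m x l)
  All-refineTailⁿ zero Px Pl = Pl
  All-refineTailⁿ (suc m) Px Pl = All-refineTail Px (All-refineTailⁿ m Px Pl)

  module _ {f : ℚ → ℚ}
           (f-medL : ∀ {a b} → P a → P b → medL (f a) (f b) ≡ f (medL a b))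
           (f-medR : ∀ {a b} → P a → P b → medR (f a) (f b) ≡ f (medR a b)) where

    refineTail-map : ∀ {x l} → P x → All P l → refineTail (f x) (map f l) ≡ map f (refineTail x l)
    refineTail-map Px [] = refl
    refineTail-map {x} {y ∷ l} Px (Py ∷ Pl) =
      cong₂ _∷_ (f-medL Px Py) (cong₂ _∷_ (f-medR Px Py) (cong (f y ∷_) (refineTail-map Py Pl)))

    refineTailⁿ-map : ∀ m {x l} → P x → All P l →
      refineTailⁿ m (f x) (map f l) ≡ map f (refineTailⁿ m x l)
    refineTailⁿ-map zero Px Pl = refl
    refineTailⁿ-map (suc m) Px Pl =
      trans (cong (refineTail _) (refineTailⁿ-map m Px Pl))
            (refineTail-map Px (All-refineTailⁿ m Px Pl))

SB≡ : ∀ n → SB n ≡ 0ℚ ∷ refineTailⁿ n 0ℚ [ 1ℚ ]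
SB≡ zero = refl
SB≡ (suc n) = trans (cong refine (SB≡ n)) (refine-∷ 0ℚ _)

length-SB : ∀ n → length (SB n) ≡ suc (3 ^ n)
length-SB n = trans (cong length (SB≡ n)) (cong suc (length-refineTailⁿ-singleton n 0ℚ 1ℚ))

at-SB-+ : ∀ n m i k → i < 3 ^ n → k ≤ 3 ^ m →
  at (SB (n + m)) (3 ^ m * i + k) ≡
  at (at (SB n) i ∷ refineTailⁿ m (at (SB n) i) [ at (SB n) (suc i) ]) k
at-SB-+ n m i k i< k≤ = begin
  at (SB (n + m)) (3 ^ m * i + k)
    ≡⟨ cong (λ l → at l (3 ^ m * i + k)) (trans (SB≡ (n + m)) (cong (0ℚ ∷_) (refineTailⁿ-+ n m 0ℚ [ 1ℚ ]))) ⟩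
  at (0ℚ ∷ refineTailⁿ m 0ℚ L) (3 ^ m * i + k)
    ≡⟨ at-block m 0ℚ L i k (subst (i <_) (sym (length-refineTailⁿ-singleton n 0ℚ 1ℚ)) i<) k≤ ⟩
  at (at (0ℚ ∷ L) i ∷ refineTailⁿ m (at (0ℚ ∷ L) i) [ at L i ]) k
    ≡⟨ cong (λ l → at (at l i ∷ refineTailⁿ m (at l i) [ at l (suc i) ]) k) (SB≡ n) ⟨
  at (at (SB n) i ∷ refineTailⁿ m (at (SB n) i) [ at (SB n) (suc i) ]) k ∎
  where
  open ≡-Reasoning
  L = refineTailⁿ n 0ℚ [ 1ℚ ]

num : ℚ → ℕ
num a = ℤ.∣ ↥ a ∣

gap : ℚ → ℕ
gap a = ↧ₙ a ∸ num a

record InUnit (a : ℚ) : Set where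
  field
    ↥≡num : ↥ a ≡ + num a
    num≤den : num a ≤ ↧ₙ a
open InUnit

InUnit-0 : InUnit 0ℚ
InUnit-0 = record { ↥≡num = refl ; num≤den = z≤n }

InUnit-1 : InUnit 1ℚ
InUnit-1 = record { ↥≡num = refl ; num≤den = s≤s z≤n }

den≡num+gap : ∀ {a} → InUnit a → ↧ₙ a ≡ num a + gap a
den≡num+gap a∈ = sym (m+[n∸m]≡n (num≤den a∈))

num+gap≢0 : ∀ {a} → InUnit a → num a + gap a ≢ 0
num+gap≢0 a∈ = subst (_≢ 0) (den≡num+gap a∈) (λ ())

coprime-num-den : ∀ a → Coprime (num a) (↧ₙ a)
coprime-num-den (mkℚ _ _ c) = recompute c

pos-linear : ∀ a b c d → + (a * b + c * d) ≡ + a ℤ.* + b ℤ.+ + c ℤ.* + d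
pos-linear a b c d = trans (ℤₚ.pos-+ (a * b) (c * d)) (cong₂ ℤ._+_ (ℤₚ.pos-* a b) (ℤₚ.pos-* c d))

cross-num : ∀ {a b} → InUnit a → InUnit b →
  cross a b ≡ + ↧ₙ a ℤ.* + num b ℤ.- + num a ℤ.* + ↧ₙ b
cross-num {a} {b} a∈ b∈ = cong₂ (λ u v → + ↧ₙ a ℤ.* u ℤ.- v ℤ.* + ↧ₙ b) (↥≡num b∈) (↥≡num a∈)

cross-gap : ∀ {a b} → InUnit a → InUnit b →
  cross a b ≡ + gap a ℤ.* + num b ℤ.- + num a ℤ.* + gap b
cross-gap {a} {b} a∈ b∈ = begin
  cross a b
    ≡⟨ cross-num a∈ b∈ ⟩
  + ↧ₙ a ℤ.* + num b ℤ.- + num a ℤ.* + ↧ₙ b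
    ≡⟨ cong₂ (λ d e → d ℤ.* + num b ℤ.- + num a ℤ.* e) (+den a∈) (+den b∈) ⟩
  (+ num a ℤ.+ + gap a) ℤ.* + num b ℤ.- + num a ℤ.* (+ num b ℤ.+ + gap b)
    ≡⟨ cancel (+ num a) (+ gap a) (+ num b) (+ gap b) ⟩
  + gap a ℤ.* + num b ℤ.- + num a ℤ.* + gap b ∎
  where
  open ≡-Reasoning
  +den : ∀ {c} → InUnit c → + ↧ₙ c ≡ + num c ℤ.+ + gap c
  +den {c} c∈ = trans (cong +_ (den≡num+gap c∈)) (ℤₚ.pos-+ (num c) (gap c))
  cancel : ∀ A T A′ T′ → (A ℤ.+ T) ℤ.* A′ ℤ.- A ℤ.* (A′ ℤ.+ T′) ≡ T ℤ.* A′ ℤ.- A ℤ.* T′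
  cancel = ℤRing.solve-∀

-- frac u 0 = u / 1 is a junk value.  Keeping frac opaque stops unification from
-- unfolding the gcd normalisation inside _/_.
opaque
  frac : ℕ → ℕ → ℚ
  frac u w = + u / suc (pred w)

  frac≡frac : ∀ {u u′ w w′} → w ≢ 0 → w′ ≢ 0 → + u ℤ.* + w′ ≡ + u′ ℤ.* + w → frac u w ≡ frac u′ w′
  frac≡frac {w = zero} w≢0 _ _ = ⊥-elim (w≢0 refl)
  frac≡frac {w′ = zero} _ w′≢0 _ = ⊥-elim (w′≢0 refl)
  frac≡frac {u} {u′} {suc w} {suc w′} _ _ eq =
    ℚₚ.fromℚᵘ-cong {ℚᵘ.mkℚᵘ (+ u) w} {ℚᵘ.mkℚᵘ (+ u′) w′} (ℚᵘ.*≡* eq)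

  frac-coprime : ∀ {u w} → w ≢ 0 → Coprime u w → ↥ frac u w ≡ + u × ↧ₙ frac u w ≡ w
  frac-coprime {w = zero} w≢0 _ = ⊥-elim (w≢0 refl)
  frac-coprime {u} {suc w} _ c =
    cong ↥_ (ℚₚ.normalize-coprime {u} {w} c) , cong ↧ₙ_ (ℚₚ.normalize-coprime {u} {w} c)

  frac-num-den : ∀ {a} → InUnit a → frac (num a) (↧ₙ a) ≡ a
  frac-num-den {a} a∈ = trans (cong (_/ ↧ₙ a) (sym (↥≡num a∈))) (ℚₚ.↥p/↧p≡p a)

  ↥-frac : ∀ u w → ↥ frac u w ≡ + num (frac u w)
  ↥-frac u w with ℚₚ.nonNegative⁻¹ (frac u w) {{ℚₚ.normalize-nonNeg u (suc (pred w))}}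
  ... | *≤* 0≤ = sym (ℤₚ.0≤i⇒+∣i∣≡i (subst (0ℤ ℤ.≤_) (ℤₚ.*-identityʳ _) 0≤))

  num-frac : ∀ u w → w ≢ 0 → num (frac u w) * w ≡ u * ↧ₙ frac u w
  num-frac u zero w≢0 = ⊥-elim (w≢0 refl)
  num-frac u (suc w) _ = ℚₚ.normalize-injective-≃ (num c) u (↧ₙ c) (suc w) (begin
    + num c / ↧ₙ c ≡⟨ cong (_/ ↧ₙ c) (↥-frac u (suc w)) ⟨
    ↥ c / ↧ₙ c     ≡⟨ ℚₚ.↥p/↧p≡p c ⟩
    c              ∎)
    where
    open ≡-Reasoning
    c : ℚ
    c = frac u (suc w)

frac-InUnit : ∀ {u w} → w ≢ 0 → u ≤ w → InUnit (frac u w)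
frac-InUnit {u} {w} w≢0 u≤w = record
  { ↥≡num = ↥-frac u w
  ; num≤den = *-cancelʳ-≤ (num c) (↧ₙ c) w {{ℕ.≢-nonZero w≢0}} (begin
      num c * w ≡⟨ num-frac u w w≢0 ⟩
      u * ↧ₙ c  ≤⟨ *-monoˡ-≤ (↧ₙ c) u≤w ⟩
      w * ↧ₙ c  ≡⟨ *-comm w (↧ₙ c) ⟩
      ↧ₙ c * w  ∎)
  }
  where
  open ≤-Reasoning
  c = frac u w

frac-proportional : ∀ N T → N + T ≢ 0 → num (frac N (N + T)) * T ≡ N * gap (frac N (N + T))
frac-proportional N T N+T≢0 = +-cancelˡ-≡ (num c * N) _ _ (begin
  num c * N + num c * T ≡⟨ *-distribˡ-+ (num c) N T ⟨
  num c * (N + T)       ≡⟨ num-frac N (N + T) N+T≢0 ⟩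
  N * ↧ₙ c              ≡⟨ cong (N *_) (den≡num+gap c∈) ⟩
  N * (num c + gap c)   ≡⟨ *-distribˡ-+ N (num c) (gap c) ⟩
  N * num c + N * gap c ≡⟨ cong (_+ N * gap c) (*-comm N (num c)) ⟩
  num c * N + N * gap c ∎)
  where
  open ≡-Reasoning
  c = frac N (N + T)
  c∈ = frac-InUnit N+T≢0 (m≤m+n N T)

mediant : ℕ → ℕ → ℚ → ℚ → ℚ
mediant i j a b = frac (i * num a + j * num b) (i * ↧ₙ a + j * ↧ₙ b)

mediant-InUnit : ∀ i j {a b} → InUnit a → InUnit b → InUnit (mediant (suc i) j a b)
mediant-InUnit i j a∈ b∈ =
  frac-InUnit (λ ()) (+-mono-≤ (*-monoʳ-≤ (suc i) (num≤den a∈)) (*-monoʳ-≤ j (num≤den b∈)))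

-- Unfolded, the denominator of a mediant is suc (pred w) with w a successor, i.e. w itself.
opaque
  unfolding frac

  medL≡mediant : ∀ {a b} → InUnit a → InUnit b → medL a b ≡ mediant 2 1 a b
  medL≡mediant {a} {b} a∈ b∈ = ℚₚ./-cong numerators denominators
    where
    open ≡-Reasoning
    numerators : + 2 ℤ.* ↥ a ℤ.+ ↥ b ≡ + (2 * num a + 1 * num b)
    numerators = begin
      + 2 ℤ.* ↥ a ℤ.+ ↥ b                 ≡⟨ cong₂ (λ u v → + 2 ℤ.* u ℤ.+ v) (↥≡num a∈) (↥≡num b∈) ⟩
      + 2 ℤ.* + num a ℤ.+ + num b         ≡⟨ cong (λ t → + 2 ℤ.* + num a ℤ.+ t) (ℤₚ.*-identityˡ (+ num b)) ⟨
      + 2 ℤ.* + num a ℤ.+ + 1 ℤ.* + num b ≡⟨ pos-linear 2 (num a) 1 (num b) ⟨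
      + (2 * num a + 1 * num b)           ∎
    denominators : ↧ₙ b + 2 * ↧ₙ a ≡ 2 * ↧ₙ a + 1 * ↧ₙ b
    denominators = trans (+-comm (↧ₙ b) _) (cong (_+_ (2 * ↧ₙ a)) (sym (*-identityˡ (↧ₙ b))))

  medR≡mediant : ∀ {a b} → InUnit a → InUnit b → medR a b ≡ mediant 1 2 a b
  medR≡mediant {a} {b} a∈ b∈ = ℚₚ./-cong numerators denominators
    where
    open ≡-Reasoning
    numerators : ↥ a ℤ.+ + 2 ℤ.* ↥ b ≡ + (1 * num a + 2 * num b)
    numerators = begin
      ↥ a ℤ.+ + 2 ℤ.* ↥ b                 ≡⟨ cong₂ (λ u v → u ℤ.+ + 2 ℤ.* v) (↥≡num a∈) (↥≡num b∈) ⟩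
      + num a ℤ.+ + 2 ℤ.* + num b         ≡⟨ cong (ℤ._+ + 2 ℤ.* + num b) (ℤₚ.*-identityˡ (+ num a)) ⟨
      + 1 ℤ.* + num a ℤ.+ + 2 ℤ.* + num b ≡⟨ pos-linear 1 (num a) 2 (num b) ⟨
      + (1 * num a + 2 * num b)           ∎
    denominators : ↧ₙ a + 2 * ↧ₙ b ≡ 1 * ↧ₙ a + 2 * ↧ₙ b
    denominators = cong (_+ 2 * ↧ₙ b) (sym (*-identityˡ (↧ₙ a)))

InUnit-medL : ∀ {a b} → InUnit a → InUnit b → InUnit (medL a b)
InUnit-medL a∈ b∈ = subst InUnit (sym (medL≡mediant a∈ b∈)) (mediant-InUnit 1 1 a∈ b∈)

InUnit-medR : ∀ {a b} → InUnit a → InUnit b → InUnit (medR a b)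
InUnit-medR a∈ b∈ = subst InUnit (sym (medR≡mediant a∈ b∈)) (mediant-InUnit 0 2 a∈ b∈)

All-InUnit-SB : ∀ n → All InUnit (SB n)
All-InUnit-SB n = subst (All InUnit) (sym (SB≡ n))
  (InUnit-0 ∷ All-refineTailⁿ InUnit-medL InUnit-medR n InUnit-0 (InUnit-1 ∷ []))

module Möbius {x y : ℚ} (x∈ : InUnit x) (y∈ : InUnit y) (det : cross x y ≡ + 1) where

  p q r s : ℕ
  p = num x
  q = ↧ₙ x
  r = num y
  s = ↧ₙ y

  -- φ acts on the coordinates (A, T) of a = A / (A + T), where its coefficients are natural.
  U W : ℕ → ℕ → ℕ
  U A T = r * A + p * T
  W A T = s * A + q * T

  φ : ℚ → ℚ
  φ a = frac (U (num a) (gap a)) (W (num a) (gap a))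

  qr≡1+ps : q * r ≡ 1 + p * s
  qr≡1+ps = ℤₚ.+-injective (begin
    + (q * r)                                      ≡⟨ ℤₚ.pos-* q r ⟩
    + q ℤ.* + r                                    ≡⟨ split (+ q ℤ.* + r) (+ p ℤ.* + s) ⟩
    (+ q ℤ.* + r ℤ.- + p ℤ.* + s) ℤ.+ + p ℤ.* + s ≡⟨ cong₂ ℤ._+_ (trans (sym (cross-num x∈ y∈)) det) (sym (ℤₚ.pos-* p s)) ⟩
    + 1 ℤ.+ + (p * s)                              ≡⟨ ℤₚ.pos-+ 1 (p * s) ⟨
    + (1 + p * s)                                  ∎)
    where
    open ≡-Reasoning
    split : ∀ i j → i ≡ (i ℤ.- j) ℤ.+ j
    split = ℤRing.solve-∀

  W*U-U*W : ∀ A T A′ T′ →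
    + W A T ℤ.* + U A′ T′ ℤ.- + U A T ℤ.* + W A′ T′ ≡ cross x y ℤ.* (+ T ℤ.* + A′ ℤ.- + A ℤ.* + T′)
  W*U-U*W A T A′ T′ = begin
    + W A T ℤ.* + U A′ T′ ℤ.- + U A T ℤ.* + W A′ T′
      ≡⟨ cong₂ ℤ._-_ (cong₂ ℤ._*_ (pos-linear s A q T) (pos-linear r A′ p T′))
                     (cong₂ ℤ._*_ (pos-linear r A p T) (pos-linear s A′ q T′)) ⟩
    (+ s ℤ.* + A ℤ.+ + q ℤ.* + T) ℤ.* (+ r ℤ.* + A′ ℤ.+ + p ℤ.* + T′) ℤ.-
    (+ r ℤ.* + A ℤ.+ + p ℤ.* + T) ℤ.* (+ s ℤ.* + A′ ℤ.+ + q ℤ.* + T′)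
      ≡⟨ determinant (+ p) (+ q) (+ r) (+ s) (+ A) (+ T) (+ A′) (+ T′) ⟩
    (+ q ℤ.* + r ℤ.- + p ℤ.* + s) ℤ.* (+ T ℤ.* + A′ ℤ.- + A ℤ.* + T′)
      ≡⟨ cong (ℤ._* (+ T ℤ.* + A′ ℤ.- + A ℤ.* + T′)) (cross-num x∈ y∈) ⟨
    cross x y ℤ.* (+ T ℤ.* + A′ ℤ.- + A ℤ.* + T′) ∎
    where
    open ≡-Reasoning
    determinant : ∀ p q r s A T A′ T′ →
      (s ℤ.* A ℤ.+ q ℤ.* T) ℤ.* (r ℤ.* A′ ℤ.+ p ℤ.* T′) ℤ.- (r ℤ.* A ℤ.+ p ℤ.* T) ℤ.* (s ℤ.* A′ ℤ.+ q ℤ.* T′)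
      ≡ (q ℤ.* r ℤ.- p ℤ.* s) ℤ.* (T ℤ.* A′ ℤ.- A ℤ.* T′)
    determinant = ℤRing.solve-∀

  W≢0 : ∀ A T → A + T ≢ 0 → W A T ≢ 0
  W≢0 A T A+T≢0 W≡0 =
    A+T≢0 (n≤0⇒n≡0 (subst (A + T ≤_) W≡0 (+-mono-≤ (m≤n*m A s) (m≤n*m T q))))

  -- The inverse matrix gives A = qU - pW and T = rW - sU, so common divisors of U, W divide A, T.
  U-W-coprime : ∀ A T → Coprime A (A + T) → Coprime (U A T) (W A T)
  U-W-coprime A T coprime {d} (d∣U , d∣W) = coprime (d∣A , ∣m∣n⇒∣m+n d∣A d∣T)
    where
    open ≡-Reasoning
    qU≡pW+A : q * U A T ≡ p * W A T + A
    qU≡pW+A = begin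
      q * U A T                     ≡⟨ expand₁ q r p A T ⟩
      q * r * A + p * (q * T)       ≡⟨ cong (λ z → z * A + p * (q * T)) qr≡1+ps ⟩
      (1 + p * s) * A + p * (q * T) ≡⟨ collect₁ p s q A T ⟩
      p * W A T + A                 ∎
      where
      expand₁ : ∀ q r p A T → q * (r * A + p * T) ≡ q * r * A + p * (q * T)
      expand₁ = solve-∀
      collect₁ : ∀ p s q A T → (1 + p * s) * A + p * (q * T) ≡ p * (s * A + q * T) + A
      collect₁ = solve-∀
    rW≡sU+T : r * W A T ≡ s * U A T + T
    rW≡sU+T = begin
      r * W A T                     ≡⟨ expand₂ r s q A T ⟩
      q * r * T + s * (r * A)       ≡⟨ cong (λ z → z * T + s * (r * A)) qr≡1+ps ⟩
      (1 + p * s) * T + s * (r * A) ≡⟨ collect₂ p s r A T ⟩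
      s * U A T + T                 ∎
      where
      expand₂ : ∀ r s q A T → r * (s * A + q * T) ≡ q * r * T + s * (r * A)
      expand₂ = solve-∀
      collect₂ : ∀ p s r A T → (1 + p * s) * T + s * (r * A) ≡ s * (r * A + p * T) + T
      collect₂ = solve-∀
    d∣A : d ∣ A
    d∣A = ∣m+n∣m⇒∣n (subst (d ∣_) qU≡pW+A (∣n⇒∣m*n q d∣U)) (∣n⇒∣m*n p d∣W)
    d∣T : d ∣ T
    d∣T = ∣m+n∣m⇒∣n (subst (d ∣_) rW≡sU+T (∣n⇒∣m*n r d∣W)) (∣n⇒∣m*n s d∣U)

  φ-coords : ∀ {a} → InUnit a → ↥ φ a ≡ + U (num a) (gap a) × ↧ₙ φ a ≡ W (num a) (gap a)
  φ-coords {a} a∈ = frac-coprime (W≢0 (num a) (gap a) (num+gap≢0 a∈))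
    (U-W-coprime (num a) (gap a) (subst (Coprime (num a)) (den≡num+gap a∈) (coprime-num-den a)))

  φ-InUnit : ∀ {a} → InUnit a → InUnit (φ a)
  φ-InUnit {a} a∈ = frac-InUnit (W≢0 (num a) (gap a) (num+gap≢0 a∈))
    (+-mono-≤ (*-monoˡ-≤ (num a) (num≤den y∈)) (*-monoˡ-≤ (gap a) (num≤den x∈)))

  φ-frac : ∀ N T → N + T ≢ 0 → φ (frac N (N + T)) ≡ frac (U N T) (W N T)
  φ-frac N T N+T≢0 = frac≡frac (W≢0 (num c) (gap c) (num+gap≢0 c∈)) (W≢0 N T N+T≢0)
    (trans (sym W*U≡U*W) (ℤₚ.*-comm (+ W (num c) (gap c)) (+ U N T)))
    where
    open ≡-Reasoning
    c = frac N (N + T)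
    c∈ = frac-InUnit N+T≢0 (m≤m+n N T)
    proportional : + gap c ℤ.* + N ≡ + num c ℤ.* + T
    proportional = begin
      + gap c ℤ.* + N ≡⟨ ℤₚ.pos-* (gap c) N ⟨
      + (gap c * N)   ≡⟨ cong +_ (trans (*-comm (gap c) N) (sym (frac-proportional N T N+T≢0))) ⟩
      + (num c * T)   ≡⟨ ℤₚ.pos-* (num c) T ⟩
      + num c ℤ.* + T ∎
    W*U≡U*W : + W (num c) (gap c) ℤ.* + U N T ≡ + U (num c) (gap c) ℤ.* + W N T
    W*U≡U*W = ℤₚ.i-j≡0⇒i≡j _ _ (begin
      + W (num c) (gap c) ℤ.* + U N T ℤ.- + U (num c) (gap c) ℤ.* + W N T
        ≡⟨ W*U-U*W (num c) (gap c) N T ⟩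
      cross x y ℤ.* (+ gap c ℤ.* + N ℤ.- + num c ℤ.* + T)
        ≡⟨ cong (cross x y ℤ.*_) (ℤₚ.i≡j⇒i-j≡0 proportional) ⟩
      cross x y ℤ.* 0ℤ
        ≡⟨ ℤₚ.*-zeroʳ (cross x y) ⟩
      0ℤ ∎)

  φ-mediant : ∀ i j {a b} → InUnit a → InUnit b → φ (mediant (suc i) j a b) ≡ mediant (suc i) j (φ a) (φ b)
  φ-mediant i j {a} {b} a∈ b∈ = begin
    φ (mediant (suc i) j a b)
      ≡⟨ cong (λ d → φ (frac N d)) N+T ⟩
    φ (frac N (N + T))
      ≡⟨ φ-frac N T (subst (_≢ 0) N+T (λ ())) ⟩
    frac (U N T) (W N T)
      ≡⟨ cong₂ frac (combine r p (suc i) j Aa Ta Ab Tb) (combine s q (suc i) j Aa Ta Ab Tb) ⟩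
    frac (suc i * U Aa Ta + j * U Ab Tb) (suc i * W Aa Ta + j * W Ab Tb)
      ≡⟨ cong₂ frac (cong₂ (λ u v → suc i * u + j * v) (num-φ a∈) (num-φ b∈))
                    (cong₂ (λ u v → suc i * u + j * v) (proj₂ (φ-coords a∈)) (proj₂ (φ-coords b∈))) ⟨
    mediant (suc i) j (φ a) (φ b) ∎
    where
    open ≡-Reasoning
    Aa = num a
    Ta = gap a
    Ab = num b
    Tb = gap b
    N = suc i * Aa + j * Ab
    T = suc i * Ta + j * Tb
    num-φ : ∀ {c} → InUnit c → num (φ c) ≡ U (num c) (gap c)
    num-φ c∈ = cong ℤ.∣_∣ (proj₁ (φ-coords c∈))
    combine : ∀ c d i j A T A′ T′ →
      c * (i * A + j * A′) + d * (i * T + j * T′) ≡ i * (c * A + d * T) + j * (c * A′ + d * T′)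
    combine = solve-∀
    regroup : ∀ i j A T A′ T′ → i * (A + T) + j * (A′ + T′) ≡ (i * A + j * A′) + (i * T + j * T′)
    regroup = solve-∀
    N+T : suc i * ↧ₙ a + j * ↧ₙ b ≡ N + T
    N+T = trans (cong₂ (λ u v → suc i * u + j * v) (den≡num+gap a∈) (den≡num+gap b∈))
                (regroup (suc i) j Aa Ta Ab Tb)

  φ-medL : ∀ {a b} → InUnit a → InUnit b → medL (φ a) (φ b) ≡ φ (medL a b)
  φ-medL {a} {b} a∈ b∈ = begin
    medL (φ a) (φ b)        ≡⟨ medL≡mediant (φ-InUnit a∈) (φ-InUnit b∈) ⟩
    mediant 2 1 (φ a) (φ b) ≡⟨ φ-mediant 1 1 a∈ b∈ ⟨
    φ (mediant 2 1 a b)     ≡⟨ cong φ (medL≡mediant a∈ b∈) ⟨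
    φ (medL a b)            ∎
    where open ≡-Reasoning

  φ-medR : ∀ {a b} → InUnit a → InUnit b → medR (φ a) (φ b) ≡ φ (medR a b)
  φ-medR {a} {b} a∈ b∈ = begin
    medR (φ a) (φ b)        ≡⟨ medR≡mediant (φ-InUnit a∈) (φ-InUnit b∈) ⟩
    mediant 1 2 (φ a) (φ b) ≡⟨ φ-mediant 0 2 a∈ b∈ ⟨
    φ (mediant 1 2 a b)     ≡⟨ cong φ (medR≡mediant a∈ b∈) ⟨
    φ (medR a b)            ∎
    where open ≡-Reasoning

  cross-φ : ∀ {a b} → InUnit a → InUnit b → cross (φ a) (φ b) ≡ cross a b
  cross-φ {a} {b} a∈ b∈ = begin
    cross (φ a) (φ b)
      ≡⟨ cong₂ ℤ._-_ (cong₂ ℤ._*_ (cong +_ (proj₂ (φ-coords a∈))) (proj₁ (φ-coords b∈)))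
                     (cong₂ ℤ._*_ (proj₁ (φ-coords a∈)) (cong +_ (proj₂ (φ-coords b∈)))) ⟩
    + W (num a) (gap a) ℤ.* + U (num b) (gap b) ℤ.- + U (num a) (gap a) ℤ.* + W (num b) (gap b)
      ≡⟨ W*U-U*W (num a) (gap a) (num b) (gap b) ⟩
    cross x y ℤ.* (+ gap a ℤ.* + num b ℤ.- + num a ℤ.* + gap b)
      ≡⟨ cong₂ ℤ._*_ det (sym (cross-gap a∈ b∈)) ⟩
    + 1 ℤ.* cross a b
      ≡⟨ ℤₚ.*-identityˡ (cross a b) ⟩
    cross a b ∎
    where open ≡-Reasoning

  φ-0 : φ 0ℚ ≡ x
  φ-0 = trans (cong₂ frac (cong₂ _+_ (*-zeroʳ r) (*-identityʳ p)) (cong₂ _+_ (*-zeroʳ s) (*-identityʳ q)))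
              (frac-num-den x∈)

  φ-1 : φ 1ℚ ≡ y
  φ-1 = trans (cong₂ frac (trans (cong₂ _+_ (*-identityʳ r) (*-zeroʳ p)) (+-identityʳ r))
                          (trans (cong₂ _+_ (*-identityʳ s) (*-zeroʳ q)) (+-identityʳ s)))
              (frac-num-den y∈)

  φ-SB : ∀ m → x ∷ refineTailⁿ m x [ y ] ≡ map φ (SB m)
  φ-SB m = begin
    x ∷ refineTailⁿ m x [ y ]
      ≡⟨ cong₂ (λ u v → u ∷ refineTailⁿ m u [ v ]) φ-0 φ-1 ⟨
    φ 0ℚ ∷ refineTailⁿ m (φ 0ℚ) (map φ [ 1ℚ ])
      ≡⟨ cong (φ 0ℚ ∷_) (refineTailⁿ-map {InUnit} InUnit-medL InUnit-medR {φ} φ-medL φ-medR m InUnit-0 (InUnit-1 ∷ [])) ⟩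
    map φ (0ℚ ∷ refineTailⁿ m 0ℚ [ 1ℚ ])
      ≡⟨ cong (map φ) (SB≡ m) ⟨
    map φ (SB m) ∎
    where open ≡-Reasoning

  cross-block : ∀ m k → k < 3 ^ m →
    cross (at (x ∷ refineTailⁿ m x [ y ]) k) (at (x ∷ refineTailⁿ m x [ y ]) (suc k)) ≡ C m k
  cross-block m k k<3ᵐ = begin
    cross (at (x ∷ refineTailⁿ m x [ y ]) k) (at (x ∷ refineTailⁿ m x [ y ]) (suc k))
      ≡⟨ cong (λ l → cross (at l k) (at l (suc k))) (φ-SB m) ⟩
    cross (at (map φ (SB m)) k) (at (map φ (SB m)) (suc k))
      ≡⟨ cong₂ cross (at-map φ (SB m) k (in-range (<⇒≤ k<3ᵐ))) (at-map φ (SB m) (suc k) (in-range k<3ᵐ)) ⟩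
    cross (φ (at (SB m) k)) (φ (at (SB m) (suc k)))
      ≡⟨ cross-φ (SB∈ k) (SB∈ (suc k)) ⟩
    C m k ∎
    where
    open ≡-Reasoning
    SB∈ = All-at InUnit-0 (All-InUnit-SB m)
    in-range : ∀ {j} → j ≤ 3 ^ m → j < length (SB m)
    in-range {j} j≤3ᵐ = subst (j <_) (sym (length-SB m)) (s≤s j≤3ᵐ)

lemma16 : (n i : ℕ) → i < 3 ^ n → C n i ≡ + 1 →
    (m k : ℕ) → k < 3 ^ m → C (n + m) (3 ^ m * i + k) ≡ C m k
lemma16 n i i<3ⁿ Cᵢ≡1 m k k<3ᵐ = begin
  C (n + m) (3 ^ m * i + k)
    ≡⟨ cong₂ cross (at-SB-+ n m i k i<3ⁿ (<⇒≤ k<3ᵐ))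
                   (trans (cong (at (SB (n + m))) (sym (+-suc (3 ^ m * i) k))) (at-SB-+ n m i (suc k) i<3ⁿ k<3ᵐ)) ⟩
  cross (at (X ∷ refineTailⁿ m X [ Y ]) k) (at (X ∷ refineTailⁿ m X [ Y ]) (suc k))
    ≡⟨ Möbius.cross-block (SB∈ i) (SB∈ (suc i)) Cᵢ≡1 m k k<3ᵐ ⟩
  C m k ∎
  where
  open ≡-Reasoning
  X = at (SB n) i
  Y = at (SB n) (suc i)
  SB∈ = All-at InUnit-0 (All-InUnit-SB n)
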